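{- For every finite multiset $G$ of I/O pairs and every pair $(B,Y)$: the I/O sequent $G\vdash(B,Y)$ is derivable in the calculus $\mathbf{C}_2$ if and only if $G\vdash_{OUT_2^+}(B,Y)$, i.e. $(B,Y)$ is derivable from the pairs in $G$ in the logic $OUT_2^+$.
   Context: Formulas are classical propositional formulas built with $\top,\bot,\neg,\wedge,\vee,\to$; $\models$ denotes classical semantic entailment. An I/O pair is an ordered pair $(A,X)$ of formulas. Rules on pairs: (TOP) $(\top,\top)$ is derivable from no premises; (BOT) $(\bot,\bot)$ is derivable from no premises; (WO) from $(A,X)$ derive $(A,Y)$ whenever $X\models Y$; (SI) from $(A,X)$ derive $(B,X)$ whenever $B\models A$; (AND) from $(A,X_1)$ and $(A,X_2)$ derive $(A,X_1\wedge X_2)$; (OR) from $(A_1,X)$ and $(A_2,X)$ derive $(A_1\vee A_2,X)$. The logic $OUT_2^+$ consists of the rules TOP, BOT, WO, SI, AND, OR. $G\vdash_{OUT_2^+}(B,Y)$ means there is a finite tree with root $(B,Y)$, each leaf an element of $G$ or an axiom (TOP or BOT), and each non-leaf node obtained from its children by one of these rules. An LK sequent $\Gamma\Rightarrow\Delta$ ($\Gamma,\Delta$ finite multisets of formulas) is derivable in Gentzen's LK iff $\bigwedge\Gamma\models\bigvee\Delta$ (empty conjunction $=\top$, empty disjunction $=\bot$). An I/O sequent has the form $G\vdash(B,Y)$ with $G$ a finite multiset of pairs. The calculus $\mathbf{C}_2$ has the rules: (IN) from the LK sequent $B\Rightarrow$ infer $G\vdash(B,Y)$; (OUT) from the LK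 sequent $\Rightarrow Y$ infer $G\vdash(B,Y)$; (E2) from $G\vdash(B\wedge\neg A,Y)$ and $G\vdash(B,Y\vee\neg X)$ infer $(A,X),G\vdash(B,Y)$. An I/O sequent is derivable in $\mathbf{C}_2$ if it is the root of a finite tree built with these rules in which every LK-sequent premise is derivable in LK. -}

module Defs where

open import Data.Nat using (ℕ)
open import Data.Bool using (Bool; true; false; not; _∧_; _∨_)
open import Data.Product using (_×_; _,_)
open import Data.List using (List; []; _∷_)
open import Data.List.Membership.Propositional using (_∈_)
open import Data.List.Relation.Binary.Permutation.Propositional using (_↭_)
open import Relation.Binary.PropositionalEquality using (_≡_)

data Formula : Set where
  atom : ℕ → Formula
  ⊤ᶠ ⊥ᶠ : Formula
  ¬ᶠ_ : Formula → Formula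
  _∧ᶠ_ _∨ᶠ_ _→ᶠ_ : Formula → Formula → Formula

infix  9 ¬ᶠ_
infixr 8 _∧ᶠ_
infixr 7 _∨ᶠ_
infixr 6 _→ᶠ_

Valuation : Set
Valuation = ℕ → Bool

⟦_⟧ : Formula → Valuation → Bool
⟦ atom n ⟧ v = v n
⟦ ⊤ᶠ ⟧ v = true
⟦ ⊥ᶠ ⟧ v = false
⟦ ¬ᶠ A ⟧ v = not (⟦ A ⟧ v)
⟦ A ∧ᶠ B ⟧ v = ⟦ A ⟧ v ∧ ⟦ B ⟧ v
⟦ A ∨ᶠ B ⟧ v = ⟦ A ⟧ v ∨ ⟦ B ⟧ v
⟦ A →ᶠ B ⟧ v = not (⟦ A ⟧ v) ∨ ⟦ B ⟧ v

_⊨_ : Formula → Formula → Set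
A ⊨ B = (v : Valuation) → ⟦ A ⟧ v ≡ true → ⟦ B ⟧ v ≡ true

Pair : Set
Pair = Formula × Formula

data _⊢OUT₂⁺_ (G : List Pair) : Pair → Set where
  leaf : ∀ {p} → p ∈ G → G ⊢OUT₂⁺ p
  TOP  : G ⊢OUT₂⁺ (⊤ᶠ , ⊤ᶠ)
  BOT  : G ⊢OUT₂⁺ (⊥ᶠ , ⊥ᶠ)
  WO   : ∀ {A X Y} → G ⊢OUT₂⁺ (A , X) → X ⊨ Y → G ⊢OUT₂⁺ (A , Y)
  SI   : ∀ {A B X} → G ⊢OUT₂⁺ (A , X) → B ⊨ A → G ⊢OUT₂⁺ (B , X)
  AND  : ∀ {A X₁ X₂} → G ⊢OUT₂⁺ (A , X₁) → G ⊢OUT₂⁺ (A , X₂)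
       → G ⊢OUT₂⁺ (A , X₁ ∧ᶠ X₂)
  OR   : ∀ {A₁ A₂ X} → G ⊢OUT₂⁺ (A₁ , X) → G ⊢OUT₂⁺ (A₂ , X)
       → G ⊢OUT₂⁺ (A₁ ∨ᶠ A₂ , X)

-- LK derivability of the single-formula sequents used by C₂,
-- given via the stated characterisation  ⋀Γ ⊨ ⋁Δ.
LK[_⇒] : Formula → Set
LK[ B ⇒] = B ⊨ ⊥ᶠ

LK[⇒_] : Formula → Set
LK[⇒ Y ] = ⊤ᶠ ⊨ Y

-- Derivability of I/O sequents G ⊢ (B,Y) in the calculus C₂.
-- G is a multiset, represented by a list up to permutation (_↭_).
data C₂ : List Pair → Pair → Set where
  IN  : ∀ {G B Y} → LK[ B ⇒] → C₂ G (B , Y)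
  OUT : ∀ {G B Y} → LK[⇒ Y ] → C₂ G (B , Y)
  E2  : ∀ {G G' A X B Y} → G' ↭ ((A , X) ∷ G)
      → C₂ G (B ∧ᶠ ¬ᶠ A , Y) → C₂ G (B , Y ∨ᶠ ¬ᶠ X)
      → C₂ G' (B , Y)

{-# OPTIONS --safe #-}

-- Soundness: every rule of C₂ is derivable in OUT₂⁺. For E2, split the input
-- B into B ∧ ¬A and B ∧ A; the first case is the left premise, and in the second
-- the pair (A , X) together with the right premise yields X ∧ (Y ∨ ¬X), hence Y.
--
-- Completeness: call a C₂ derivation canonical when E2 always eliminates the
-- first pair of the list and IN/OUT are used only once the list is empty.
-- Canonical derivations are monotone in both components (SI and WO) and closed
-- under AND and OR, the latter two by induction on the list after distributing
-- the extra disjunct ¬X, resp. conjunct ¬A, over the new connective. So every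
-- OUT₂⁺ derivation has a canonical C₂ counterpart.

module Submission where

open import Defs
open import Data.Bool using (true; false; _∧_; _∨_)
open import Data.Bool.Properties
  using (∧-conicalˡ; ∧-conicalʳ; ∧-inverseʳ; ∨-inverseʳ; ∧-distribʳ-∨; ∨-distribʳ-∧)
open import Data.List using (List; []; _∷_)
open import Data.List.Membership.Propositional using (_∈_)
open import Data.List.Relation.Binary.Subset.Propositional using (_⊆_)
open import Data.List.Relation.Unary.Any using (here; there)
open import Data.List.Relation.Binary.Permutation.Propositional using (↭-sym; ↭-refl)
open import Data.List.Relation.Binary.Permutation.Propositional.Properties using (∈-resp-↭)
open import Data.Product using (_,_)
open import Function.Base using (_∘_)
open import Function.Bundles using (_⇔_; mk⇔)
open import Relation.Binary.PropositionalEquality using (_≡_; refl; sym; cong; cong₂; subst)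

private variable
  G G' : List Pair
  p : Pair
  A A₁ A₂ B B' X X₁ X₂ Y Y' : Formula

-- A ⊨ B unfolds to a statement about ⟦ A ⟧ and ⟦ B ⟧, from which Agda cannot
-- recover A and B, so entailment lemmas take their formulas explicitly.

⊨-trans : ∀ A B C → A ⊨ B → B ⊨ C → A ⊨ C
⊨-trans A B C A⊨B B⊨C v = B⊨C v ∘ A⊨B v

∧ᶠ-elimˡ : ∀ A B → (A ∧ᶠ B) ⊨ A
∧ᶠ-elimˡ A B v = ∧-conicalˡ (⟦ A ⟧ v) (⟦ B ⟧ v)

∧ᶠ-elimʳ : ∀ A B → (A ∧ᶠ B) ⊨ B
∧ᶠ-elimʳ A B v = ∧-conicalʳ (⟦ A ⟧ v) (⟦ B ⟧ v)

∧ᶠ-intro : ∀ A X₁ X₂ → A ⊨ X₁ → A ⊨ X₂ → A ⊨ (X₁ ∧ᶠ X₂)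
∧ᶠ-intro A X₁ X₂ A⊨X₁ A⊨X₂ v a = cong₂ _∧_ (A⊨X₁ v a) (A⊨X₂ v a)

∨ᶠ-introˡ : ∀ A B → A ⊨ (A ∨ᶠ B)
∨ᶠ-introˡ A B v a = cong (_∨ ⟦ B ⟧ v) a

∨ᶠ-introʳ : ∀ A B → B ⊨ (A ∨ᶠ B)
∨ᶠ-introʳ A B v b with ⟦ A ⟧ v
... | true  = refl
... | false = b

∨ᶠ-elim : ∀ A₁ A₂ X → A₁ ⊨ X → A₂ ⊨ X → (A₁ ∨ᶠ A₂) ⊨ X
∨ᶠ-elim A₁ A₂ X A₁⊨X A₂⊨X v a with ⟦ A₁ ⟧ v in a₁
... | true  = A₁⊨X v a₁
... | false = A₂⊨X v a

∧ᶠ-monoˡ : ∀ B' B X → B' ⊨ B → (B' ∧ᶠ X) ⊨ (B ∧ᶠ X)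
∧ᶠ-monoˡ B' B X B'⊨B =
  ∧ᶠ-intro (B' ∧ᶠ X) B X (⊨-trans (B' ∧ᶠ X) B' B (∧ᶠ-elimˡ B' X) B'⊨B) (∧ᶠ-elimʳ B' X)

∨ᶠ-monoˡ : ∀ Y Y' X → Y ⊨ Y' → (Y ∨ᶠ X) ⊨ (Y' ∨ᶠ X)
∨ᶠ-monoˡ Y Y' X Y⊨Y' =
  ∨ᶠ-elim Y X (Y' ∨ᶠ X) (⊨-trans Y Y' (Y' ∨ᶠ X) Y⊨Y' (∨ᶠ-introˡ Y' X)) (∨ᶠ-introʳ Y' X)

∧ᶠ-distribʳ-∨ᶠ : ∀ X A₁ A₂ → ((A₁ ∨ᶠ A₂) ∧ᶠ X) ⊨ ((A₁ ∧ᶠ X) ∨ᶠ (A₂ ∧ᶠ X))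
∧ᶠ-distribʳ-∨ᶠ X A₁ A₂ v = subst (_≡ true) (∧-distribʳ-∨ (⟦ X ⟧ v) (⟦ A₁ ⟧ v) (⟦ A₂ ⟧ v))

∨ᶠ-distribʳ-∧ᶠ : ∀ X X₁ X₂ → ((X₁ ∨ᶠ X) ∧ᶠ (X₂ ∨ᶠ X)) ⊨ ((X₁ ∧ᶠ X₂) ∨ᶠ X)
∨ᶠ-distribʳ-∧ᶠ X X₁ X₂ v = subst (_≡ true) (sym (∨-distribʳ-∧ (⟦ X ⟧ v) (⟦ X₁ ⟧ v) (⟦ X₂ ⟧ v)))

excluded-middle : ∀ X → ⊤ᶠ ⊨ (X ∨ᶠ ¬ᶠ X)
excluded-middle X v _ = ∨-inverseʳ (⟦ X ⟧ v)

non-contradiction : ∀ A → (A ∧ᶠ ¬ᶠ A) ⊨ ⊥ᶠ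
non-contradiction A v = subst (_≡ true) (∧-inverseʳ (⟦ A ⟧ v))

case-split : ∀ B A → B ⊨ ((B ∧ᶠ ¬ᶠ A) ∨ᶠ (B ∧ᶠ A))
case-split B A v b with ⟦ B ⟧ v | ⟦ A ⟧ v
... | true | true  = refl
... | true | false = refl

disjunctive-syllogism : ∀ X Y → (X ∧ᶠ (Y ∨ᶠ ¬ᶠ X)) ⊨ Y
disjunctive-syllogism X Y v h with ⟦ X ⟧ v | ⟦ Y ⟧ v
... | true | true = refl

OUT₂⁺-weaken : G ⊆ G' → G ⊢OUT₂⁺ p → G' ⊢OUT₂⁺ p
OUT₂⁺-weaken G⊆G' (leaf p∈G) = leaf (G⊆G' p∈G)
OUT₂⁺-weaken G⊆G' TOP        = TOP
OUT₂⁺-weaken G⊆G' BOT        = BOT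
OUT₂⁺-weaken G⊆G' (WO d X⊨Y) = WO (OUT₂⁺-weaken G⊆G' d) X⊨Y
OUT₂⁺-weaken G⊆G' (SI d B⊨A) = SI (OUT₂⁺-weaken G⊆G' d) B⊨A
OUT₂⁺-weaken G⊆G' (AND d e)  = AND (OUT₂⁺-weaken G⊆G' d) (OUT₂⁺-weaken G⊆G' e)
OUT₂⁺-weaken G⊆G' (OR d e)   = OR (OUT₂⁺-weaken G⊆G' d) (OUT₂⁺-weaken G⊆G' e)

OUT₂⁺-IN : B ⊨ ⊥ᶠ → G ⊢OUT₂⁺ (B , Y)
OUT₂⁺-IN B⊨⊥ = SI (WO BOT λ _ ()) B⊨⊥

OUT₂⁺-OUT : ⊤ᶠ ⊨ Y → G ⊢OUT₂⁺ (B , Y)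
OUT₂⁺-OUT ⊤⊨Y = SI (WO TOP ⊤⊨Y) λ _ _ → refl

OUT₂⁺-E2 : G ⊢OUT₂⁺ (A , X) → G ⊢OUT₂⁺ (B ∧ᶠ ¬ᶠ A , Y) → G ⊢OUT₂⁺ (B , Y ∨ᶠ ¬ᶠ X)
         → G ⊢OUT₂⁺ (B , Y)
OUT₂⁺-E2 {G} {A} {X} {B} {Y} AX B¬A⇒Y B⇒Y∨¬X =
  SI (OR B¬A⇒Y BA⇒Y) (case-split B A)
  where
  BA⇒Y : G ⊢OUT₂⁺ (B ∧ᶠ A , Y)
  BA⇒Y = WO (AND (SI AX (∧ᶠ-elimʳ B A)) (SI B⇒Y∨¬X (∧ᶠ-elimˡ B A)))
            (disjunctive-syllogism X Y)

C₂⇒OUT₂⁺ : C₂ G p → G ⊢OUT₂⁺ p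
C₂⇒OUT₂⁺ (IN B⊨⊥)  = OUT₂⁺-IN B⊨⊥
C₂⇒OUT₂⁺ (OUT ⊤⊨Y) = OUT₂⁺-OUT ⊤⊨Y
C₂⇒OUT₂⁺ {G'} (E2 {G} G'↭AX∷G d₁ d₂) =
  OUT₂⁺-E2 (leaf (∈-resp-↭ AX∷G↭G' (here refl)))
           (OUT₂⁺-weaken G⊆G' (C₂⇒OUT₂⁺ d₁)) (OUT₂⁺-weaken G⊆G' (C₂⇒OUT₂⁺ d₂))
  where
  AX∷G↭G' = ↭-sym G'↭AX∷G

  G⊆G' : G ⊆ G'
  G⊆G' = ∈-resp-↭ AX∷G↭G' ∘ there

data Canonical : List Pair → Pair → Set where
  IN  : B ⊨ ⊥ᶠ → Canonical [] (B , Y)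
  OUT : ⊤ᶠ ⊨ Y → Canonical [] (B , Y)
  E2  : Canonical G (B ∧ᶠ ¬ᶠ A , Y) → Canonical G (B , Y ∨ᶠ ¬ᶠ X)
      → Canonical ((A , X) ∷ G) (B , Y)

Canonical⇒C₂ : Canonical G p → C₂ G p
Canonical⇒C₂ (IN B⊨⊥)   = IN B⊨⊥
Canonical⇒C₂ (OUT ⊤⊨Y)  = OUT ⊤⊨Y
Canonical⇒C₂ (E2 d₁ d₂) = E2 ↭-refl (Canonical⇒C₂ d₁) (Canonical⇒C₂ d₂)

Canonical-SI : B' ⊨ B → Canonical G (B , Y) → Canonical G (B' , Y)
Canonical-SI {B'} {B} B'⊨B (IN B⊨⊥) = IN (⊨-trans B' B ⊥ᶠ B'⊨B B⊨⊥)
Canonical-SI _ (OUT ⊤⊨Y) = OUT ⊤⊨Y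
Canonical-SI {B'} {B} B'⊨B (E2 {A = A} d₁ d₂) =
  E2 (Canonical-SI (∧ᶠ-monoˡ B' B (¬ᶠ A) B'⊨B) d₁) (Canonical-SI B'⊨B d₂)

Canonical-WO : Y ⊨ Y' → Canonical G (B , Y) → Canonical G (B , Y')
Canonical-WO _ (IN B⊨⊥) = IN B⊨⊥
Canonical-WO {Y} {Y'} Y⊨Y' (OUT ⊤⊨Y) = OUT (⊨-trans ⊤ᶠ Y Y' ⊤⊨Y Y⊨Y')
Canonical-WO {Y} {Y'} Y⊨Y' (E2 {X = X} d₁ d₂) =
  E2 (Canonical-WO Y⊨Y' d₁) (Canonical-WO (∨ᶠ-monoˡ Y Y' (¬ᶠ X) Y⊨Y') d₂)

Canonical-IN : ∀ G → B ⊨ ⊥ᶠ → Canonical G (B , Y)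
Canonical-IN [] B⊨⊥ = IN B⊨⊥
Canonical-IN {B} ((A , _) ∷ G) B⊨⊥ =
  E2 (Canonical-IN G (⊨-trans (B ∧ᶠ ¬ᶠ A) B ⊥ᶠ (∧ᶠ-elimˡ B (¬ᶠ A)) B⊨⊥))
     (Canonical-IN G B⊨⊥)

Canonical-OUT : ∀ G → ⊤ᶠ ⊨ Y → Canonical G (B , Y)
Canonical-OUT [] ⊤⊨Y = OUT ⊤⊨Y
Canonical-OUT {Y} ((_ , X) ∷ G) ⊤⊨Y =
  E2 (Canonical-OUT G ⊤⊨Y)
     (Canonical-OUT G (⊨-trans ⊤ᶠ Y (Y ∨ᶠ ¬ᶠ X) ⊤⊨Y (∨ᶠ-introˡ Y (¬ᶠ X))))

Canonical-AND : Canonical G (A , X₁) → Canonical G (A , X₂) → Canonical G (A , X₁ ∧ᶠ X₂)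
Canonical-AND (IN A⊨⊥) _        = IN A⊨⊥
Canonical-AND (OUT _)  (IN A⊨⊥) = IN A⊨⊥
Canonical-AND {X₁ = X₁} {X₂} (OUT ⊤⊨X₁) (OUT ⊤⊨X₂) = OUT (∧ᶠ-intro ⊤ᶠ X₁ X₂ ⊤⊨X₁ ⊤⊨X₂)
Canonical-AND {X₁ = X₁} {X₂} (E2 {X = X} d₁ d₂) (E2 e₁ e₂) =
  E2 (Canonical-AND d₁ e₁)
     (Canonical-WO (∨ᶠ-distribʳ-∧ᶠ (¬ᶠ X) X₁ X₂) (Canonical-AND d₂ e₂))

Canonical-OR : Canonical G (A₁ , X) → Canonical G (A₂ , X) → Canonical G (A₁ ∨ᶠ A₂ , X)
Canonical-OR (OUT ⊤⊨X) _         = OUT ⊤⊨X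
Canonical-OR (IN _)    (OUT ⊤⊨X) = OUT ⊤⊨X
Canonical-OR {A₁ = A₁} {A₂ = A₂} (IN A₁⊨⊥) (IN A₂⊨⊥) = IN (∨ᶠ-elim A₁ A₂ ⊥ᶠ A₁⊨⊥ A₂⊨⊥)
Canonical-OR {A₁ = A₁} {A₂ = A₂} (E2 {A = A} d₁ d₂) (E2 e₁ e₂) =
  E2 (Canonical-SI (∧ᶠ-distribʳ-∨ᶠ (¬ᶠ A) A₁ A₂) (Canonical-OR d₁ e₁))
     (Canonical-OR d₂ e₂)

Canonical-∈ : (A , X) ∈ G → Canonical G (A , X)
Canonical-∈ {A} {X} {_ ∷ G} (here refl) =
  E2 (Canonical-IN G (non-contradiction A)) (Canonical-OUT G (excluded-middle X))
Canonical-∈ {A} {X} {(A' , X') ∷ _} (there AX∈G) =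
  E2 (Canonical-SI (∧ᶠ-elimˡ A (¬ᶠ A')) (Canonical-∈ AX∈G))
     (Canonical-WO (∨ᶠ-introˡ X (¬ᶠ X')) (Canonical-∈ AX∈G))

OUT₂⁺⇒Canonical : G ⊢OUT₂⁺ p → Canonical G p
OUT₂⁺⇒Canonical (leaf p∈G) = Canonical-∈ p∈G
OUT₂⁺⇒Canonical {G} TOP    = Canonical-OUT G λ _ _ → refl
OUT₂⁺⇒Canonical {G} BOT    = Canonical-IN G λ _ ()
OUT₂⁺⇒Canonical (WO d X⊨Y) = Canonical-WO X⊨Y (OUT₂⁺⇒Canonical d)
OUT₂⁺⇒Canonical (SI d B⊨A) = Canonical-SI B⊨A (OUT₂⁺⇒Canonical d)
OUT₂⁺⇒Canonical (AND d e)  = Canonical-AND (OUT₂⁺⇒Canonical d) (OUT₂⁺⇒Canonical e)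
OUT₂⁺⇒Canonical (OR d e)   = Canonical-OR (OUT₂⁺⇒Canonical d) (OUT₂⁺⇒Canonical e)

theorem1 : (G : List Pair) (B Y : Formula) → C₂ G (B , Y) ⇔ (G ⊢OUT₂⁺ (B , Y))
theorem1 G B Y = mk⇔ C₂⇒OUT₂⁺ (Canonical⇒C₂ ∘ OUT₂⁺⇒Canonical)
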